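{- For every $n\ge 3$, the partition $\pi_n$ of $V(\mathcal{Q}(n))$ produced by Algorithm 1 is an equitable partition of $\mathcal{Q}(n)$ with $\frac{(\lceil n/2\rceil+1)\lceil n/2\rceil}{2}$ cells.
   Context: The $n$-Queens' graph $\mathcal{Q}(n)$ has vertex set $[n]^2$ (squares $(i,j)$ of an $n\times n$ chessboard, row $i$ from top, column $j$ from left); two distinct vertices $(i,j),(p,q)$ are adjacent iff $i=p$, or $j=q$, or $i+j=p+q$, or $i-j=p-q$. A partition $V(G)=V_1\dot\cup\cdots\dot\cup V_k$ is equitable if for all $i,j$ every vertex of $V_i$ has the same number of neighbours in $V_j$. Algorithm 1: let $h=\lceil n/2\rceil$; give the squares $(i,j)$ with $1\le i\le j\le h$ pairwise distinct labels $0,1,\dots,\frac{(h+1)h}{2}-1$ (column by column, top to bottom); then extend labels by reflection: first reflect this triangle across the vertical middle line of the board (mapping $(i,j)\mapsto(i,n+1-j)$), then reflect each of the two resulting triangles across its hypotenuse (a diagonal of the board), which labels all squares in the top $h$ rows, then reflect the top $\lfloor n/2\rfloor$ rows across the horizontal middle line ($(i,j)\mapsto(n+1-i,j)$). The cells of $\pi_n$ are the sets of squares with equal labels (equivalently, the orbits of the squares under the symmetry group of the square board generated by these reflections). -}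

module Defs where

open import Data.Nat using (ℕ; _+_; _*_; _∸_; _/_; _⊓_; _⊔_; ⌈_/2⌉)
import Data.Nat as ℕ
open import Data.Fin using (Fin; toℕ)
import Data.Fin as Fin
open import Data.List using (List; allFin; cartesianProduct; filter; length)
open import Data.Product using (_×_; _,_)
open import Data.Product.Properties using (≡-dec)
open import Data.Sum using (_⊎_)
open import Relation.Nullary using (¬_; Dec; ¬?; _×-dec_; _⊎-dec_)
open import Relation.Binary.PropositionalEquality using (_≡_)

-- Squares of the n × n board, 0-indexed: (i , j) = row i, column j
-- (the paper's square (i+1, j+1)).
Sq : ℕ → Set
Sq n = Fin n × Fin n

squares : (n : ℕ) → List (Sq n)
squares n = cartesianProduct (allFin n) (allFin n)

-- Adjacency in the n-Queens' graph Q(n): distinct squares in the same row,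
-- column, anti-diagonal (i+j = p+q) or diagonal (i-j = p-q, i.e. i+q = p+j).
QAdj : (n : ℕ) → Sq n → Sq n → Set
QAdj n (i , j) (p , q) =
  ¬ ((i , j) ≡ (p , q)) ×
  (i ≡ p ⊎ j ≡ q ⊎ toℕ i + toℕ j ≡ toℕ p + toℕ q ⊎ toℕ i + toℕ q ≡ toℕ p + toℕ j)

QAdj? : (n : ℕ) → (u v : Sq n) → Dec (QAdj n u v)
QAdj? n (i , j) (p , q) =
  ¬? (≡-dec Fin._≟_ Fin._≟_ (i , j) (p , q)) ×-dec
  (i Fin.≟ p ⊎-dec j Fin.≟ q ⊎-dec
   (toℕ i + toℕ j ℕ.≟ toℕ p + toℕ q) ⊎-dec (toℕ i + toℕ q ℕ.≟ toℕ p + toℕ j))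

-- A partition of V(Q(n)) is given by a labelling c : Sq n → ℕ; its cells are
-- the nonempty sets of squares with equal label.
-- Number of neighbours of u lying in the cell with label b.
degIn : (n : ℕ) → (Sq n → ℕ) → Sq n → ℕ → ℕ
degIn n c u b = length (filter (λ w → QAdj? n u w ×-dec (c w ℕ.≟ b)) (squares n))

IsEquitable : (n : ℕ) → (Sq n → ℕ) → Set
IsEquitable n c = ∀ (u v : Sq n) (b : ℕ) → c u ≡ c v → degIn n c u b ≡ degIn n c v b

-- Algorithm 1 (h = ⌈n/2⌉).  The base triangle consists of the (0-indexed)
-- squares (a , b) with a ≤ b < h, labelled column by column, top to bottom:
-- square (a , b) gets label b(b+1)/2 + a, i.e. labels 0 … (h+1)h/2 - 1.
triLabel : ℕ → ℕ → ℕ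
triLabel a b = (b * (ℕ.suc b)) / 2 + a

-- The reflections of Algorithm 1: the horizontal-middle-line reflection
-- i ↦ n-1-i, the vertical-middle-line reflection j ↦ n-1-j, and the
-- reflections across the diagonals.  A square receives the label of the
-- unique base-triangle square it is mapped to by these reflections:
-- fold the row and the column into the first h positions, then reflect
-- across the main diagonal if needed (order the two coordinates).
fold : ℕ → ℕ → ℕ
fold n x = x ⊓ (n ∸ 1 ∸ x)

piLabel : (n : ℕ) → Sq n → ℕ
piLabel n (i , j) =
  let r = fold n (toℕ i)
      s = fold n (toℕ j)
  in triLabel (r ⊓ s) (r ⊔ s)

numCells : ℕ → ℕ
numCells n = ((⌈ n /2⌉ + 1) * ⌈ n /2⌉) / 2

{-# OPTIONS --safe #-}
module Submission where

-- The cells of π_n are the orbits of the symmetry group of the square acting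
-- on the board.  That group is generated by the reflection of the rows and the
-- transposition, and both are automorphisms of Q(n): they permute rows and
-- columns among themselves and map each family of diagonals onto a family of
-- diagonals.  An automorphism preserving the labelling does not change the
-- number of neighbours a square has in any cell, so squares of one orbit have
-- the same neighbour counts.  The label of the orbit of the folded square (r , s),
-- r ≤ s < ⌈n/2⌉, is T(s) + r with T the triangular numbers, and
-- (r , s) ↦ T(s) + r is a bijection onto [0, T(⌈n/2⌉)).

open import Defs
open import Data.Bool using (Bool; true; false)
open import Data.Fin as Fin using (Fin; toℕ; opposite; fromℕ<)
open import Data.Fin.Permutation using (reverse)
open import Data.Fin.Properties
  using (opposite-involutive; opposite-prop; toℕ<n; toℕ-injective; toℕ-fromℕ<)
open import Data.List using (List; []; _∷_; _++_; map; filter; length; tabulate; allFin; cartesianProduct)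
open import Data.List.Properties using (map-++; map-∘; map-tabulate)
open import Data.Nat
open import Data.Nat.DivMod using (m*n/n≡m)
open import Data.Nat.ListAction using () renaming (sum to sumᴸ)
open import Data.Nat.ListAction.Properties using (sum-++)
open import Data.Nat.Properties
open import Data.Nat.Tactic.RingSolver using (solve-∀)
open import Data.Product using (_×_; _,_; ∃; ∃₂)
open import Data.Sum using (_⊎_; inj₁; inj₂)
open import Function using (id; _∘_; mk⇔)
open import Level using (0ℓ)
open import Relation.Binary.Definitions using (tri<; tri≈; tri>)
open import Relation.Binary.PropositionalEquality
open import Relation.Nullary using (does; _×-dec_; contradiction)
open import Relation.Nullary.Decidable using (does-⇔)
open import Relation.Unary using (Pred; Decidable)
open import Algebra.Properties.CommutativeMonoid.Sum +-0-commutativeMonoid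
  using (sum; sum-syntax; ∑-comm; sum-permute; sum-cong-≗)

triangle : ℕ → ℕ
triangle zero    = 0
triangle (suc b) = triangle b + suc b

triangle-*2 : ∀ b → b * suc b ≡ triangle b * 2
triangle-*2 zero    = refl
triangle-*2 (suc b) = begin
  suc b * suc (suc b)    ≡⟨ expand b ⟩
  b * suc b + 2 * suc b  ≡⟨ cong (_+ 2 * suc b) (triangle-*2 b) ⟩
  triangle b * 2 + 2 * suc b ≡⟨ collect (triangle b) b ⟩
  (triangle b + suc b) * 2 ∎
  where
  open ≡-Reasoning
  expand : ∀ b → suc b * suc (suc b) ≡ b * suc b + 2 * suc b
  expand = solve-∀
  collect : ∀ t b → t * 2 + 2 * suc b ≡ (t + suc b) * 2
  collect = solve-∀

*-suc/2≡triangle : ∀ b → b * suc b / 2 ≡ triangle b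
*-suc/2≡triangle b = trans (cong (_/ 2) (triangle-*2 b)) (m*n/n≡m (triangle b) 2)

triLabel≡triangle+ : ∀ a b → triLabel a b ≡ triangle b + a
triLabel≡triangle+ a b = cong (_+ a) (*-suc/2≡triangle b)

triangle-mono-≤ : ∀ {b b'} → b ≤ b' → triangle b ≤ triangle b'
triangle-mono-≤ {b} b≤b' = go (≤⇒≤′ b≤b')
  where
  go : ∀ {b'} → b ≤′ b' → triangle b ≤ triangle b'
  go ≤′-refl                 = ≤-refl
  go (≤′-step {b'} b≤′b') = ≤-trans (go b≤′b') (m≤m+n (triangle b') (suc b'))

triangle-cancel-< : ∀ {b b'} → triangle b < triangle b' → b < b'
triangle-cancel-< T<T = ≰⇒> λ b'≤b → <⇒≱ T<T (triangle-mono-≤ b'≤b)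

triangle+<triangle : ∀ {a b b'} → a ≤ b → b < b' → triangle b + a < triangle b'
triangle+<triangle {b = b} a≤b b<b' =
  ≤-trans (+-monoʳ-< (triangle b) (s≤s a≤b)) (triangle-mono-≤ b<b')

triangle+-injective : ∀ {a b a' b'} → a ≤ b → a' ≤ b' →
  triangle b + a ≡ triangle b' + a' → a ≡ a' × b ≡ b'
triangle+-injective {a} {b} {a'} {b'} a≤b a'≤b' eq with <-cmp b b'
... | tri< b<b' _ _ = contradiction eq (<⇒≢ (≤-trans (triangle+<triangle a≤b b<b') (m≤m+n _ a')))
... | tri> _ _ b'<b = contradiction (sym eq) (<⇒≢ (≤-trans (triangle+<triangle a'≤b' b'<b) (m≤m+n _ a)))
... | tri≈ _ refl _ = +-cancelˡ-≡ (triangle b) a a' eq , refl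

triangle+-surjective : ∀ l → ∃₂ λ b a → a ≤ b × triangle b + a ≡ l
triangle+-surjective zero = 0 , 0 , z≤n , refl
triangle+-surjective (suc l) with triangle+-surjective l
... | b , a , a≤b , eq with m≤n⇒m<n∨m≡n a≤b
...   | inj₁ a<b  = b , suc a , a<b , trans (+-suc (triangle b) a) (cong suc eq)
...   | inj₂ refl = suc a , 0 , z≤n , trans (+-identityʳ _) (trans (+-suc (triangle a) a) (cong suc eq))

numCells≡triangle : ∀ n → numCells n ≡ triangle ⌈ n /2⌉
numCells≡triangle n = begin
  (h + 1) * h / 2   ≡⟨ cong (_/ 2) (trans (*-comm (h + 1) h) (cong (h *_) (+-comm h 1))) ⟩
  h * suc h / 2     ≡⟨ *-suc/2≡triangle h ⟩
  triangle h        ∎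
  where
  open ≡-Reasoning
  h = ⌈ n /2⌉

1+2m≤n⇒m<⌈n/2⌉ : ∀ m n → suc (2 * m) ≤ n → m < ⌈ n /2⌉
1+2m≤n⇒m<⌈n/2⌉ zero    (suc n)       _                = s≤s z≤n
1+2m≤n⇒m<⌈n/2⌉ (suc m) (suc (suc n)) (s≤s (s≤s le)) =
  s≤s (1+2m≤n⇒m<⌈n/2⌉ m n (≤-trans (≤-reflexive (sym (+-suc m (m + 0)))) le))

m<⌈n/2⌉⇒1+2m≤n : ∀ m n → m < ⌈ n /2⌉ → suc (2 * m) ≤ n
m<⌈n/2⌉⇒1+2m≤n zero    (suc n)       _         = s≤s z≤n
m<⌈n/2⌉⇒1+2m≤n (suc m) (suc (suc n)) (s≤s lt) =
  s≤s (s≤s (≤-trans (≤-reflexive (+-suc m (m + 0))) (m<⌈n/2⌉⇒1+2m≤n m n lt)))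

fold<⌈n/2⌉ : ∀ {k x} → x ≤ k → fold (suc k) x < ⌈ suc k /2⌉
fold<⌈n/2⌉ {k} {x} x≤k = 1+2m≤n⇒m<⌈n/2⌉ f (suc k) (s≤s (begin
  f + (f + 0)     ≡⟨ cong (f +_) (+-identityʳ f) ⟩
  f + f           ≤⟨ +-mono-≤ (m⊓n≤m x (k ∸ x)) (m⊓n≤n x (k ∸ x)) ⟩
  x + (k ∸ x)     ≡⟨ m+[n∸m]≡n x≤k ⟩
  k               ∎))
  where
  open ≤-Reasoning
  f = fold (suc k) x

fold-reflect : ∀ {k x} → x ≤ k → fold (suc k) (k ∸ x) ≡ fold (suc k) x
fold-reflect {k} {x} x≤k = trans (cong ((k ∸ x) ⊓_) (m∸[m∸n]≡n x≤k)) (⊓-comm (k ∸ x) x)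

fold-≡⇒≡∨reflect : ∀ {k x y} → x ≤ k → y ≤ k →
  fold (suc k) x ≡ fold (suc k) y → x ≡ y ⊎ x ≡ k ∸ y
fold-≡⇒≡∨reflect {k} {x} {y} x≤k y≤k eq with ⊓-sel x (k ∸ x) | ⊓-sel y (k ∸ y)
... | inj₁ fx | inj₁ fy = inj₁ (trans (sym fx) (trans eq fy))
... | inj₁ fx | inj₂ fy = inj₂ (trans (sym fx) (trans eq fy))
... | inj₂ fx | inj₁ fy = inj₂ (trans (sym (m∸[m∸n]≡n x≤k)) (cong (k ∸_) (trans (sym fx) (trans eq fy))))
... | inj₂ fx | inj₂ fy = inj₁ (trans (sym (m∸[m∸n]≡n x≤k))
  (trans (cong (k ∸_) (trans (sym fx) (trans eq fy))) (m∸[m∸n]≡n y≤k)))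

fold-fixes-first-half : ∀ {k x} → suc (2 * x) ≤ suc k → fold (suc k) x ≡ x
fold-fixes-first-half {k} {x} le = m≤n⇒m⊓n≡m (m+n≤o⇒m≤o∸n x (begin
  x + x        ≡⟨ cong (x +_) (+-identityʳ x) ⟨
  x + (x + 0)  ≤⟨ s≤s⁻¹ le ⟩
  k            ∎))
  where open ≤-Reasoning

fold-opposite : ∀ {n} (i : Fin n) → fold n (toℕ (opposite i)) ≡ fold n (toℕ i)
fold-opposite {suc k} i =
  trans (cong (fold (suc k)) (opposite-prop i)) (fold-reflect (s≤s⁻¹ (toℕ<n i)))

fold-≡⇒≡∨opposite : ∀ {n} (i p : Fin n) →
  fold n (toℕ i) ≡ fold n (toℕ p) → i ≡ p ⊎ i ≡ opposite p
fold-≡⇒≡∨opposite {suc k} i p eq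
  with fold-≡⇒≡∨reflect (s≤s⁻¹ (toℕ<n i)) (s≤s⁻¹ (toℕ<n p)) eq
... | inj₁ i≡p = inj₁ (toℕ-injective i≡p)
... | inj₂ i≡p̄ = inj₂ (toℕ-injective (trans i≡p̄ (sym (opposite-prop p))))

fold-toℕ<⌈n/2⌉ : ∀ {n} (i : Fin n) → fold n (toℕ i) < ⌈ n /2⌉
fold-toℕ<⌈n/2⌉ {suc k} i = fold<⌈n/2⌉ (s≤s⁻¹ (toℕ<n i))

fold-toℕ-onto : ∀ {n} x → x < ⌈ n /2⌉ → ∃ λ (i : Fin n) → fold n (toℕ i) ≡ x
fold-toℕ-onto {n} x x<h with m<⌈n/2⌉⇒1+2m≤n x n x<h
... | le@(s≤s _) = fromℕ< x<n , trans (cong (fold n) (toℕ-fromℕ< x<n)) (fold-fixes-first-half le)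
  where
  x<n : x < n
  x<n = ≤-trans (s≤s (m≤m+n x (x + 0))) le

⊓⊔-sorted : ∀ r s → (r ⊓ s ≡ r × r ⊔ s ≡ s) ⊎ (r ⊓ s ≡ s × r ⊔ s ≡ r)
⊓⊔-sorted r s with ≤-total r s
... | inj₁ r≤s = inj₁ (m≤n⇒m⊓n≡m r≤s , m≤n⇒m⊔n≡n r≤s)
... | inj₂ s≤r = inj₂ (m≥n⇒m⊓n≡n s≤r , m≥n⇒m⊔n≡m s≤r)

⊓⊔-injective : ∀ {r s r' s'} → r ⊓ s ≡ r' ⊓ s' → r ⊔ s ≡ r' ⊔ s' →
  (r ≡ r' × s ≡ s') ⊎ (r ≡ s' × s ≡ r')
⊓⊔-injective {r} {s} {r'} {s'} eq⊓ eq⊔ with ⊓⊔-sorted r s | ⊓⊔-sorted r' s'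
... | inj₁ (m , M) | inj₁ (m' , M') = inj₁ (trans (sym m) (trans eq⊓ m') , trans (sym M) (trans eq⊔ M'))
... | inj₁ (m , M) | inj₂ (m' , M') = inj₂ (trans (sym m) (trans eq⊓ m') , trans (sym M) (trans eq⊔ M'))
... | inj₂ (m , M) | inj₁ (m' , M') = inj₂ (trans (sym M) (trans eq⊔ M') , trans (sym m) (trans eq⊓ m'))
... | inj₂ (m , M) | inj₂ (m' , M') = inj₁ (trans (sym M) (trans eq⊔ M') , trans (sym m) (trans eq⊓ m'))

piLabel≡triangle+ : ∀ {n} (i j : Fin n) → let r = fold n (toℕ i); s = fold n (toℕ j) in
  piLabel n (i , j) ≡ triangle (r ⊔ s) + r ⊓ s
piLabel≡triangle+ {n} i j = triLabel≡triangle+ (fold n (toℕ i) ⊓ fold n (toℕ j)) (fold n (toℕ i) ⊔ fold n (toℕ j))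

piLabel-≡⇒folds : ∀ {n} {i j p q : Fin n} → piLabel n (i , j) ≡ piLabel n (p , q) →
  let f = λ (x : Fin n) → fold n (toℕ x) in
  (f i ≡ f p × f j ≡ f q) ⊎ (f i ≡ f q × f j ≡ f p)
piLabel-≡⇒folds {n} {i} {j} {p} {q} eq with
  triangle+-injective (m⊓n≤m⊔n (f i) (f j)) (m⊓n≤m⊔n (f p) (f q))
    (trans (sym (piLabel≡triangle+ i j)) (trans eq (piLabel≡triangle+ p q)))
  where f = λ (x : Fin n) → fold n (toℕ x)
... | eq⊓ , eq⊔ = ⊓⊔-injective eq⊓ eq⊔

piLabel<numCells : ∀ {n} (w : Sq n) → piLabel n w < numCells n
piLabel<numCells {n} (i , j) = subst₂ _<_ (sym (piLabel≡triangle+ i j)) (sym (numCells≡triangle n))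
  (triangle+<triangle (m⊓n≤m⊔n r s) (⊔-lub (fold-toℕ<⌈n/2⌉ i) (fold-toℕ<⌈n/2⌉ j)))
  where
  r = fold n (toℕ i)
  s = fold n (toℕ j)

piLabel-onto : ∀ {n} l → l < numCells n → ∃ λ (w : Sq n) → piLabel n w ≡ l
piLabel-onto {n} l l<N with triangle+-surjective l
... | b , a , a≤b , Tb+a≡l with fold-toℕ-onto a (≤-<-trans a≤b b<h) | fold-toℕ-onto b b<h
  where
  b<h : b < ⌈ n /2⌉
  b<h = triangle-cancel-< (≤-<-trans (≤-trans (m≤m+n (triangle b) a) (≤-reflexive Tb+a≡l))
                                     (≤-trans l<N (≤-reflexive (numCells≡triangle n))))
...   | i , fi≡a | j , fj≡b = (i , j) , (begin
  piLabel n (i , j)                ≡⟨ piLabel≡triangle+ i j ⟩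
  triangle (fi ⊔ fj) + fi ⊓ fj     ≡⟨ cong₂ (λ x y → triangle (x ⊔ y) + x ⊓ y) fi≡a fj≡b ⟩
  triangle (a ⊔ b) + a ⊓ b         ≡⟨ cong₂ (λ x y → triangle x + y) (m≤n⇒m⊔n≡n a≤b) (m≤n⇒m⊓n≡m a≤b) ⟩
  triangle b + a                   ≡⟨ Tb+a≡l ⟩
  l                                ∎)
  where
  open ≡-Reasoning
  fi = fold n (toℕ i)
  fj = fold n (toℕ j)

indicator : Bool → ℕ
indicator true  = 1
indicator false = 0

length-filter≡sum : ∀ {A : Set} {P : Pred A 0ℓ} (P? : Decidable P) (xs : List A) →
  length (filter P? xs) ≡ sumᴸ (map (indicator ∘ does ∘ P?) xs)
length-filter≡sum P? []       = refl
length-filter≡sum P? (x ∷ xs) with does (P? x)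
... | true  = cong suc (length-filter≡sum P? xs)
... | false = length-filter≡sum P? xs

sum-cartesianProduct : ∀ {A B : Set} (g : A × B → ℕ) (xs : List A) (ys : List B) →
  sumᴸ (map g (cartesianProduct xs ys)) ≡ sumᴸ (map (λ x → sumᴸ (map (λ y → g (x , y)) ys)) xs)
sum-cartesianProduct g []       ys = refl
sum-cartesianProduct g (x ∷ xs) ys = begin
  sumᴸ (map g (map (x ,_) ys ++ cartesianProduct xs ys))
    ≡⟨ cong sumᴸ (map-++ g (map (x ,_) ys) _) ⟩
  sumᴸ (map g (map (x ,_) ys) ++ map g (cartesianProduct xs ys))
    ≡⟨ sum-++ (map g (map (x ,_) ys)) _ ⟩
  sumᴸ (map g (map (x ,_) ys)) + sumᴸ (map g (cartesianProduct xs ys))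
    ≡⟨ cong₂ _+_ (cong sumᴸ (sym (map-∘ ys))) (sum-cartesianProduct g xs ys) ⟩
  sumᴸ (map (λ y → g (x , y)) ys) + sumᴸ (map (λ x → sumᴸ (map (λ y → g (x , y)) ys)) xs) ∎
  where open ≡-Reasoning

sum-tabulate : ∀ {n} (f : Fin n → ℕ) → sumᴸ (tabulate f) ≡ sum f
sum-tabulate {zero}  f = refl
sum-tabulate {suc n} f = cong (f Fin.zero +_) (sum-tabulate (f ∘ Fin.suc))

sum-map-allFin : ∀ {n} (f : Fin n → ℕ) → sumᴸ (map f (allFin n)) ≡ sum f
sum-map-allFin {n} f = trans (cong sumᴸ (map-tabulate id f)) (sum-tabulate f)

∑□ : ∀ {n} → (Sq n → ℕ) → ℕ
∑□ {n} f = ∑[ i < n ] ∑[ j < n ] f (i , j)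

sum-map-squares : ∀ {n} (f : Sq n → ℕ) → sumᴸ (map f (squares n)) ≡ ∑□ f
sum-map-squares {n} f = begin
  sumᴸ (map f (squares n))
    ≡⟨ sum-cartesianProduct f (allFin n) (allFin n) ⟩
  sumᴸ (map (λ i → sumᴸ (map (λ j → f (i , j)) (allFin n))) (allFin n))
    ≡⟨ sum-map-allFin (λ i → sumᴸ (map (λ j → f (i , j)) (allFin n))) ⟩
  ∑[ i < n ] sumᴸ (map (λ j → f (i , j)) (allFin n))
    ≡⟨ sum-cong-≗ (λ i → sum-map-allFin (λ j → f (i , j))) ⟩
  ∑□ f ∎
  where open ≡-Reasoning

neighbourIndicator : ∀ n → (Sq n → ℕ) → Sq n → ℕ → Sq n → ℕ
neighbourIndicator n c u b w = indicator (does (QAdj? n u w ×-dec (c w ≟ b)))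

degIn≡∑□ : ∀ n c u b → degIn n c u b ≡ ∑□ (neighbourIndicator n c u b)
degIn≡∑□ n c u b =
  trans (length-filter≡sum (λ w → QAdj? n u w ×-dec (c w ≟ b)) (squares n))
        (sum-map-squares (neighbourIndicator n c u b))

SameLine : ∀ {n} → Sq n → Sq n → Set
SameLine (i , j) (p , q) =
  i ≡ p ⊎ j ≡ q ⊎ toℕ i + toℕ j ≡ toℕ p + toℕ q ⊎ toℕ i + toℕ q ≡ toℕ p + toℕ j

record LabelledSymmetry (n : ℕ) (c : Sq n → ℕ) (g : Sq n → Sq n) : Set where
  field
    involutive      : ∀ w → g (g w) ≡ w
    preserves-line  : ∀ u w → SameLine u w → SameLine (g u) (g w)
    preserves-label : ∀ w → c (g w) ≡ c w
    ∑□-invariant    : ∀ f → ∑□ (f ∘ g) ≡ ∑□ f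

  preserves-QAdj : ∀ u w → QAdj n u w → QAdj n (g u) (g w)
  preserves-QAdj u w (u≢w , line) =
    (λ gu≡gw → u≢w (trans (sym (involutive u)) (trans (cong g gu≡gw) (involutive w)))) ,
    preserves-line u w line

  reflects-QAdj : ∀ u w → QAdj n (g u) (g w) → QAdj n u w
  reflects-QAdj u w adj = subst₂ (QAdj n) (involutive u) (involutive w) (preserves-QAdj (g u) (g w) adj)

SameDegrees : ∀ n → (Sq n → ℕ) → Sq n → Sq n → Set
SameDegrees n c u v = ∀ b → degIn n c u b ≡ degIn n c v b

degIn-invariant : ∀ {n c g} → LabelledSymmetry n c g → ∀ u → SameDegrees n c (g u) u
degIn-invariant {n} {c} {g} G u b = begin
  degIn n c (g u) b                   ≡⟨ degIn≡∑□ n c (g u) b ⟩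
  ∑□ (neighbourIndicator n c (g u) b)      ≡⟨ ∑□-invariant (neighbourIndicator n c (g u) b) ⟨
  ∑□ (neighbourIndicator n c (g u) b ∘ g)  ≡⟨ sum-cong-≗ (λ i → sum-cong-≗ (λ j → pointwise (i , j))) ⟩
  ∑□ (neighbourIndicator n c u b)          ≡⟨ degIn≡∑□ n c u b ⟨
  degIn n c u b                       ∎
  where
  open ≡-Reasoning
  open LabelledSymmetry G
  pointwise : ∀ w → neighbourIndicator n c (g u) b (g w) ≡ neighbourIndicator n c u b w
  pointwise w = cong indicator (does-⇔
    (mk⇔ (λ (adj , cw≡b) → reflects-QAdj u w adj , trans (sym (preserves-label w)) cw≡b)
         (λ (adj , cw≡b) → preserves-QAdj u w adj , trans (preserves-label w) cw≡b))
    (QAdj? n (g u) (g w) ×-dec (c (g w) ≟ b)) (QAdj? n u w ×-dec (c w ≟ b)))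

flipRows : ∀ {n} → Sq n → Sq n
flipRows (i , j) = (opposite i , j)

transpose : ∀ {n} → Sq n → Sq n
transpose (i , j) = (j , i)

-- Applied with m + i = m' + p = n, this moves a diagonal equation of the
-- board to the reflected board without any subtraction.
+-rebalance : ∀ m i m' p j q → m + i ≡ m' + p → i + j ≡ p + q → m + q ≡ m' + j
+-rebalance m i m' p j q e₁ e₂ = +-cancelʳ-≡ (i + p) (m + q) (m' + j) (begin
  m + q + (i + p)     ≡⟨ shuffle m q i p ⟩
  (m + i) + (p + q)   ≡⟨ cong₂ _+_ e₁ (sym e₂) ⟩
  (m' + p) + (i + j)  ≡⟨ shuffle' m' p i j ⟩
  m' + j + (i + p)    ∎)
  where
  open ≡-Reasoning
  shuffle : ∀ m q i p → m + q + (i + p) ≡ (m + i) + (p + q)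
  shuffle = solve-∀
  shuffle' : ∀ m' p i j → (m' + p) + (i + j) ≡ m' + j + (i + p)
  shuffle' = solve-∀

opposite+suc≡n : ∀ {n} (i : Fin n) → toℕ (opposite i) + suc (toℕ i) ≡ n
opposite+suc≡n i = trans (cong (_+ suc (toℕ i)) (opposite-prop i)) (m∸n+n≡m (toℕ<n i))

flipRows-preserves-line : ∀ {n} (u w : Sq n) → SameLine u w → SameLine (flipRows u) (flipRows w)
flipRows-preserves-line (i , j) (p , q) (inj₁ i≡p)                = inj₁ (cong opposite i≡p)
flipRows-preserves-line (i , j) (p , q) (inj₂ (inj₁ j≡q))         = inj₂ (inj₁ j≡q)
flipRows-preserves-line (i , j) (p , q) (inj₂ (inj₂ (inj₁ anti))) = inj₂ (inj₂ (inj₂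
  (+-rebalance _ (suc (toℕ i)) _ (suc (toℕ p)) (toℕ j) (toℕ q) (trans (opposite+suc≡n i) (sym (opposite+suc≡n p))) (cong suc anti))))
flipRows-preserves-line (i , j) (p , q) (inj₂ (inj₂ (inj₂ diag))) = inj₂ (inj₂ (inj₁
  (+-rebalance _ (suc (toℕ i)) _ (suc (toℕ p)) (toℕ q) (toℕ j) (trans (opposite+suc≡n i) (sym (opposite+suc≡n p))) (cong suc diag))))

transpose-preserves-line : ∀ {n} (u w : Sq n) → SameLine u w → SameLine (transpose u) (transpose w)
transpose-preserves-line (i , j) (p , q) (inj₁ i≡p)                = inj₂ (inj₁ i≡p)
transpose-preserves-line (i , j) (p , q) (inj₂ (inj₁ j≡q))         = inj₁ j≡q
transpose-preserves-line (i , j) (p , q) (inj₂ (inj₂ (inj₁ anti))) =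
  inj₂ (inj₂ (inj₁ (trans (+-comm (toℕ j) (toℕ i)) (trans anti (+-comm (toℕ p) (toℕ q))))))
transpose-preserves-line (i , j) (p , q) (inj₂ (inj₂ (inj₂ diag))) =
  inj₂ (inj₂ (inj₂ (trans (+-comm (toℕ j) (toℕ p)) (trans (sym diag) (+-comm (toℕ i) (toℕ q))))))

flipRows-symmetry : ∀ n → LabelledSymmetry n (piLabel n) flipRows
flipRows-symmetry n = record
  { involutive      = λ (i , j) → cong (_, j) (opposite-involutive i)
  ; preserves-line  = flipRows-preserves-line
  ; preserves-label = λ (i , j) →
      cong (λ r → triLabel (r ⊓ fold n (toℕ j)) (r ⊔ fold n (toℕ j))) (fold-opposite i)
  ; ∑□-invariant    = λ f → sym (sum-permute (λ i → ∑[ j < n ] f (i , j)) reverse)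
  }

transpose-symmetry : ∀ n → LabelledSymmetry n (piLabel n) transpose
transpose-symmetry n = record
  { involutive      = λ _ → refl
  ; preserves-line  = transpose-preserves-line
  ; preserves-label = λ (i , j) →
      cong₂ triLabel (⊓-comm (fold n (toℕ j)) (fold n (toℕ i))) (⊔-comm (fold n (toℕ j)) (fold n (toℕ i)))
  ; ∑□-invariant    = λ f → ∑-comm (λ i j → f (j , i))
  }

sameDegrees-transpose : ∀ {n} (w : Sq n) → SameDegrees n (piLabel n) (transpose w) w
sameDegrees-transpose {n} = degIn-invariant (transpose-symmetry n)

sameDegrees-row : ∀ {n} {i p : Fin n} → fold n (toℕ i) ≡ fold n (toℕ p) →
  ∀ j → SameDegrees n (piLabel n) (i , j) (p , j)
sameDegrees-row {n} {i} {p} eq j with fold-≡⇒≡∨opposite i p eq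
... | inj₁ refl = λ _ → refl
... | inj₂ refl = degIn-invariant (flipRows-symmetry n) (p , j)

-- Reflecting the columns is flipRows conjugated by transpose.
sameDegrees-column : ∀ {n} {j q : Fin n} → fold n (toℕ j) ≡ fold n (toℕ q) →
  ∀ p → SameDegrees n (piLabel n) (p , j) (p , q)
sameDegrees-column {n} {j} {q} eq p with fold-≡⇒≡∨opposite j q eq
... | inj₁ refl = λ _ → refl
... | inj₂ refl = λ b → trans (sameDegrees-transpose (opposite q , p) b)
  (trans (degIn-invariant (flipRows-symmetry n) (q , p) b) (sameDegrees-transpose (p , q) b))

piLabel-equitable : ∀ n → IsEquitable n (piLabel n)
piLabel-equitable n (i , j) (p , q) b eq with piLabel-≡⇒folds eq
... | inj₁ (i~p , j~q) = trans (sameDegrees-row i~p j b) (sameDegrees-column j~q p b)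
... | inj₂ (i~q , j~p) = trans (sameDegrees-row i~q j b)
  (trans (sameDegrees-column j~p q b) (sameDegrees-transpose (p , q) b))

theorem12 : (n : ℕ) → 3 ≤ n →
    IsEquitable n (piLabel n) ×
    (∀ (s : Sq n) → piLabel n s < numCells n) ×
    (∀ (l : ℕ) → l < numCells n → ∃ λ (s : Sq n) → piLabel n s ≡ l)
theorem12 n _ = piLabel-equitable n , piLabel<numCells , piLabel-onto
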